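{- The hypoplactic congruence $\ddot{\sim}$ on the free monoid $C_2^*$ is not finitely generated (as a monoid congruence). Therefore $\mathrm{hypo}(\mathcal{C}_2)$ has no finite presentation.
   Context: $|w|_a$ denotes the number of occurrences of the letter $a$ in the word $w$. Let $C_2=\{1<2<\bar2<\bar1\}$ and $C_2^*$ the free monoid over it; the symbols $3$ and $\bar3$ never occur. For $i\in\{1,2\}$, $w$ has an $i$-inversion if $w=w_1xw_2yw_3$ with $x\in\{i,\overline{i+1}\}$, $y\in\{i+1,\bar i\}$. Quasi-crystal structure on $C_2^*$: $\mathrm{wt}(w)=(|w|_1-|w|_{\bar1},|w|_2-|w|_{\bar2})$. For $i\in\{1,2\}$: if $w$ has an $i$-inversion then $\ddot{\varepsilon}_i(w)=\ddot{\varphi}_i(w)=+\infty$ and $\ddot{e}_i(w),\ddot{f}_i(w)$ are undefined; otherwise $\ddot{\varepsilon}_i(w)=|w|_{i+1}+|w|_{\bar i}$, $\ddot{\varphi}_i(w)=|w|_i+|w|_{\overline{i+1}}$; $\ddot{e}_i(w)$ is defined iff $\ddot{\varepsilon}_i(w)>0$ and is obtained by replacing the right-most letter of $w$ in $\{i+1,\bar i\}$ by its image ($\ddot{e}_1:2\mapsto1,\bar1\mapsto\bar2$; $\ddot{e}_2:\bar2\mapsto2$); $\ddot{f}_i(w)$ is defined iff $\ddot{\varphi}_i(w)>0$ and is obtained by replacing the left-most letter of $w$ in $\{i,\overline{i+1}\}$ by its image ($\ddot{f}_1:1\mapsto2,\bar2\mapsto\bar1$; $\ddot{f}_2:2\mapsto\bar2$).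 The connected component $C_2^*(w)$ is the set of words obtained from $w$ by finitely many (defined) applications of these operators. Hypoplactic congruence: $u\ddot{\sim}v$ iff there is a bijection $\psi:C_2^*(u)\to C_2^*(v)$ with $\psi(u)=v$ preserving $\mathrm{wt},\ddot{\varepsilon}_i,\ddot{\varphi}_i$ and such that $\ddot{e}_i(\psi(x))$ is defined iff $\ddot{e}_i(x)$ is (then $\psi(\ddot{e}_i(x))=\ddot{e}_i(\psi(x))$), likewise for $\ddot{f}_i$. It is a monoid congruence on $C_2^*$; $\mathrm{hypo}(\mathcal{C}_2)=C_2^*/\ddot{\sim}$. -}

module Defs where

open import Data.Bool using (Bool; true; false; _∧_; _∨_; if_then_else_)
open import Data.Nat using (ℕ; zero; suc)
open import Data.Integer using (ℤ; +_; _-_)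
open import Data.Product using (Σ; ∃; _×_; _,_)
open import Data.Maybe using (Maybe; just; nothing)
import Data.Maybe as Maybe
open import Data.List using (List; []; _∷_; _++_; concatMap)
open import Data.Bool.ListAction using (any)
open import Data.List.Membership.Propositional using (_∈_)
open import Data.Fin using (Fin)
open import Relation.Binary.PropositionalEquality using (_≡_)

-- The alphabet C₂ = {1 < 2 < 2̄ < 1̄}
data Letter : Set where
  c1 c2 c2̄ c1̄ : Letter

Word : Set
Word = List Letter

data Idx : Set where
  i1 i2 : Idx

-- x-letters of index i: {i, overline(i+1)}   (3̄ never occurs)
isX : Idx → Letter → Bool
isX i1 c1  = true
isX i1 c2̄ = true
isX i2 c2  = true
isX _  _   = false

-- y-letters of index i: {i+1, overline i}   (3 never occurs)
isY : Idx → Letter → Bool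
isY i1 c2  = true
isY i1 c1̄ = true
isY i2 c2̄ = true
isY _  _   = false

count : (Letter → Bool) → Word → ℕ
count P []      = zero
count P (a ∷ w) = if P a then suc (count P w) else count P w

isL : Letter → Letter → Bool
isL c1 c1 = true
isL c2 c2 = true
isL c2̄ c2̄ = true
isL c1̄ c1̄ = true
isL _ _ = false

hasInv : Idx → Word → Bool
hasInv i []      = false
hasInv i (a ∷ w) = (isX i a ∧ any (isY i) w) ∨ hasInv i w

data ℕ∞ : Set where
  fin : ℕ → ℕ∞
  ∞   : ℕ∞

wt : Word → ℤ × ℤ
wt w = ((+ count (isL c1) w) - (+ count (isL c1̄) w))
     , ((+ count (isL c2) w) - (+ count (isL c2̄) w))

ε̈ : Idx → Word → ℕ∞
ε̈ i w = if hasInv i w then ∞ else fin (count (isY i) w)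

φ̈ : Idx → Word → ℕ∞
φ̈ i w = if hasInv i w then ∞ else fin (count (isX i) w)

eL : Idx → Letter → Maybe Letter
eL i1 c2  = just c1
eL i1 c1̄ = just c2̄
eL i2 c2̄ = just c2
eL _  _   = nothing

fL : Idx → Letter → Maybe Letter
fL i1 c1  = just c2
fL i1 c2̄ = just c1̄
fL i2 c2  = just c2̄
fL _  _   = nothing

replaceFirst : (Letter → Maybe Letter) → Word → Maybe Word
replaceFirst g []      = nothing
replaceFirst g (a ∷ w) with g a
... | just b  = just (b ∷ w)
... | nothing = Maybe.map (a ∷_) (replaceFirst g w)

replaceLast : (Letter → Maybe Letter) → Word → Maybe Word
replaceLast g []      = nothing
replaceLast g (a ∷ w) with replaceLast g w
... | just w' = just (a ∷ w')
... | nothing with g a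
...   | just b  = just (b ∷ w)
...   | nothing = nothing

-- ë_i, f̈_i : partial operators (undefined when there is an i-inversion,
-- or when ε̈_i = 0 resp. φ̈_i = 0, i.e. no relevant letter exists)
ë : Idx → Word → Maybe Word
ë i w = if hasInv i w then nothing else replaceLast (eL i) w

f̈ : Idx → Word → Maybe Word
f̈ i w = if hasInv i w then nothing else replaceFirst (fL i) w

-- Reach u w : w lies in the connected component C₂*(u)
data Reach (u : Word) : Word → Set where
  here  : Reach u u
  stepE : ∀ {v w} i → Reach u v → ë i v ≡ just w → Reach u w
  stepF : ∀ {v w} i → Reach u v → f̈ i v ≡ just w → Reach u w

-- Hypoplactic relation: a bijection ψ : C₂*(u) → C₂*(v) with ψ(u) = v,
-- preserving wt, ε̈_i, φ̈_i and commuting with ë_i, f̈_i (including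
-- definedness).  ψ is given as a function on words; only its restriction
-- to C₂*(u) matters.
record QCIso (u v : Word) (ψ : Word → Word) : Set where
  field
    maps   : ∀ x → Reach u x → Reach v (ψ x)
    inj    : ∀ x y → Reach u x → Reach u y → ψ x ≡ ψ y → x ≡ y
    surj   : ∀ y → Reach v y → ∃ λ x → Reach u x × ψ x ≡ y
    base   : ψ u ≡ v
    pres-wt : ∀ x → Reach u x → wt (ψ x) ≡ wt x
    pres-ε  : ∀ i x → Reach u x → ε̈ i (ψ x) ≡ ε̈ i x
    pres-φ  : ∀ i x → Reach u x → φ̈ i (ψ x) ≡ φ̈ i x
    comm-e  : ∀ i x → Reach u x → ë i (ψ x) ≡ Maybe.map ψ (ë i x)
    comm-f  : ∀ i x → Reach u x → f̈ i (ψ x) ≡ Maybe.map ψ (f̈ i x)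

_∼̈_ : Word → Word → Set
u ∼̈ v = Σ (Word → Word) (QCIso u v)

data Gen {A : Set} (R : List (List A × List A)) : List A → List A → Set where
  gen   : ∀ {u v} → (u , v) ∈ R → Gen R u v
  grefl : ∀ {u} → Gen R u u
  gsym  : ∀ {u v} → Gen R u v → Gen R v u
  gtrans : ∀ {u v w} → Gen R u v → Gen R v w → Gen R u w
  gcong : ∀ {u v} (p q : List A) → Gen R u v → Gen R (p ++ u ++ q) (p ++ v ++ q)

FinitelyGenerated : Set
FinitelyGenerated =
  Σ (List (Word × Word)) λ R → ∀ u v → (Gen R u v → u ∼̈ v) × (u ∼̈ v → Gen R u v)

-- hypo(C₂) = C₂*/∼̈ admits a finite presentation ⟨ Fin n | R ⟩:
-- a map g of the n generators into C₂* whose induced homomorphism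
-- Fin n* → C₂*/∼̈ is surjective with kernel the congruence generated by R.
FinitelyPresented : Set
FinitelyPresented =
  Σ ℕ λ n → Σ (Fin n → Word) λ g → Σ (List (List (Fin n) × List (Fin n))) λ R →
    (∀ w → ∃ λ u → concatMap g u ∼̈ w) ×
    (∀ u v → (Gen R u v → concatMap g u ∼̈ concatMap g v)
           × (concatMap g u ∼̈ concatMap g v → Gen R u v))

-- The words u[N] = 2̄ 2 1ᴺ 2̄ and v[N] = 2̄ 2 2̄ 1ᴺ both contain a 1-inversion and a
-- 2-inversion, so each is an isolated vertex, and having equal weight they are ∼̈-related.
-- But every factor of u[N] of length at most N is ∼̈-related only to itself: isomorphisms
-- preserve ε̈ and φ̈, which pin down words such as 1ᵏ, and they commute with the operators,
-- which propagates this to the other short factors. So relations whose sides have length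
-- at most N never rewrite u[N], and no finite set of relations generates ∼̈. A finite
-- presentation fails in the same way: every letter is alone in its ∼̈-class, hence the image
-- of a word in the generators, and the presenting relations map to relations between
-- words of C₂* of bounded length.

module Submission where

open import Defs
open import Data.Bool using (true; false; _∨_)
open import Data.Bool.Properties using (∨-zeroʳ)
open import Data.Bool.ListAction using (any)
import Data.Integer as ℤ
open import Data.List using (List; []; _∷_; _++_; [_]; replicate; length; concatMap)
open import Data.List.Membership.Propositional using (_∈_)
open import Data.List.Relation.Unary.Any using (here; there)
open import Data.List.Properties using (∷-injectiveʳ; ++-conicalˡ; ++-conicalʳ; ++-assoc; ++-identityʳ; concatMap-++)
open import Data.Maybe using (just; nothing)
import Data.Maybe as Maybe
open import Data.Maybe.Properties using (just-injective)
open import Data.Nat using (ℕ; zero; suc; _+_; _≤_; z≤n; s≤s)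
open import Data.Nat.Properties
  using (suc-injective; +-comm; +-suc; +-identityʳ; ≤-trans; m≤n⇒m≤1+n; m≤m+n; m≤n+m)
open import Data.Product using (∃; ∃₂; _×_; _,_; proj₁; proj₂; swap)
import Data.Product as Product
open import Function using (id; _∘_)
open import Data.Sum using (_⊎_; inj₁; inj₂)
import Data.Sum as Sum
open import Relation.Nullary using (¬_; contradiction)
open import Relation.Binary.PropositionalEquality hiding ([_])

ones twos : ℕ → Word
ones n = replicate n c1
twos n = replicate n c2

count-++ : ∀ P (xs ys : Word) → count P (xs ++ ys) ≡ count P xs + count P ys
count-++ P []       ys = refl
count-++ P (a ∷ xs) ys with P a
... | true  = cong suc (count-++ P xs ys)
... | false = count-++ P xs ys

count-ones-true : ∀ {P} n → P c1 ≡ true → count P (ones n) ≡ n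
count-ones-true zero    h = refl
count-ones-true (suc n) h rewrite h = cong suc (count-ones-true n h)

count-ones-false : ∀ {P} n → P c1 ≡ false → count P (ones n) ≡ 0
count-ones-false zero    h = refl
count-ones-false (suc n) h rewrite h = count-ones-false n h

count-ones-2̄ : ∀ {P} k → P c1 ≡ false → count P (ones k ++ [ c2̄ ]) ≡ count P [ c2̄ ]
count-ones-2̄ k h = trans (count-++ _ (ones k) [ c2̄ ]) (cong (_+ _) (count-ones-false k h))

count-swap : ∀ P (xs ys : Word) → count P (xs ++ ys) ≡ count P (ys ++ xs)
count-swap P xs ys = begin
  count P (xs ++ ys)          ≡⟨ count-++ P xs ys ⟩
  count P xs + count P ys     ≡⟨ +-comm (count P xs) _ ⟩
  count P ys + count P xs     ≡⟨ count-++ P ys xs ⟨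
  count P (ys ++ xs)          ∎
  where open ≡-Reasoning

count-cong-++ˡ : ∀ P xs {ys zs} → count P ys ≡ count P zs → count P (xs ++ ys) ≡ count P (xs ++ zs)
count-cong-++ˡ P xs {ys} {zs} e = begin
  count P (xs ++ ys)        ≡⟨ count-++ P xs ys ⟩
  count P xs + count P ys   ≡⟨ cong (count P xs +_) e ⟩
  count P xs + count P zs   ≡⟨ count-++ P xs zs ⟨
  count P (xs ++ zs)        ∎
  where open ≡-Reasoning

wt-cong : ∀ {u v} → (∀ P → count P u ≡ count P v) → wt u ≡ wt v
wt-cong h = cong₂ _,_ (cong₂ ℤ._-_ (cong ℤ.+_ (h _)) (cong ℤ.+_ (h _)))
                      (cong₂ ℤ._-_ (cong ℤ.+_ (h _)) (cong ℤ.+_ (h _)))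

any-ones : ∀ {P} n → P c1 ≡ false → any P (ones n) ≡ false
any-ones zero    h = refl
any-ones (suc n) h rewrite h = any-ones n h

any-++ʳ : ∀ P (xs : Word) {ys} → any P ys ≡ true → any P (xs ++ ys) ≡ true
any-++ʳ P []       h = h
any-++ʳ P (a ∷ xs) h = trans (cong (P a ∨_) (any-++ʳ P xs h)) (∨-zeroʳ (P a))

hasInv-ones : ∀ i n → hasInv i (ones n) ≡ false
hasInv-ones i1 zero    = refl
hasInv-ones i1 (suc n) rewrite any-ones {isY i1} n refl = hasInv-ones i1 n
hasInv-ones i2 zero    = refl
hasInv-ones i2 (suc n) = hasInv-ones i2 n

replaceLast-ones : ∀ g n → g c1 ≡ nothing → replaceLast g (ones n) ≡ nothing
replaceLast-ones g zero    h = refl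
replaceLast-ones g (suc n) h rewrite replaceLast-ones g n h | h = refl

#X #Y : Idx → Word → ℕ
#X i = count (isX i)
#Y i = count (isY i)

count⇒ones : ∀ w → #Y i1 w ≡ 0 → #Y i2 w ≡ 0 → #X i2 w ≡ 0 → w ≡ ones (#X i1 w)
count⇒ones []         _  _  _  = refl
count⇒ones (c1  ∷ w) y₁ y₂ x₂ = cong (c1 ∷_) (count⇒ones w y₁ y₂ x₂)
count⇒ones (c2  ∷ w) () _  _
count⇒ones (c2̄ ∷ w) _  () _
count⇒ones (c1̄ ∷ w) () _  _

count⇒ones-2̄-ones : ∀ w → #Y i1 w ≡ 0 → #X i2 w ≡ 0 → #Y i2 w ≡ 1 →
                    ∃₂ λ b d → suc (b + d) ≡ #X i1 w × w ≡ ones b ++ c2̄ ∷ ones d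
count⇒ones-2̄-ones []         _  _  ()
count⇒ones-2̄-ones (c1  ∷ w) y₁ x₂ y₂ with count⇒ones-2̄-ones w y₁ x₂ y₂
... | b , d , n≡ , w≡ = suc b , d , cong suc n≡ , cong (c1 ∷_) w≡
count⇒ones-2̄-ones (c2  ∷ w) () _  _
count⇒ones-2̄-ones (c2̄ ∷ w) y₁ x₂ y₂ =
  0 , #X i1 w , refl , cong (c2̄ ∷_) (count⇒ones w y₁ (suc-injective y₂) x₂)
count⇒ones-2̄-ones (c1̄ ∷ w) () _  _

count⇒1̄s : ∀ w → #X i1 w ≡ 0 → #X i2 w ≡ 0 → #Y i2 w ≡ 0 → w ≡ replicate (#Y i1 w) c1̄
count⇒1̄s []         _  _  _  = refl
count⇒1̄s (c1  ∷ w) () _  _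
count⇒1̄s (c2  ∷ w) _  () _
count⇒1̄s (c2̄ ∷ w) () _  _
count⇒1̄s (c1̄ ∷ w) x₁ x₂ y₂ = cong (c1̄ ∷_) (count⇒1̄s w x₁ x₂ y₂)

#X₂≤#Y₁ : ∀ w → #X i2 w ≤ #Y i1 w
#X₂≤#Y₁ []         = z≤n
#X₂≤#Y₁ (c1  ∷ w) = #X₂≤#Y₁ w
#X₂≤#Y₁ (c2  ∷ w) = s≤s (#X₂≤#Y₁ w)
#X₂≤#Y₁ (c2̄ ∷ w) = #X₂≤#Y₁ w
#X₂≤#Y₁ (c1̄ ∷ w) = m≤n⇒m≤1+n (#X₂≤#Y₁ w)

count⇒[2] : ∀ w → #X i1 w ≡ 0 → #Y i1 w ≡ 1 → #X i2 w ≡ 1 → #Y i2 w ≡ 0 → w ≡ [ c2 ]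
count⇒[2] []         _  _  () _
count⇒[2] (c1  ∷ w) () _  _  _
count⇒[2] (c2  ∷ w) x₁ y₁ x₂ y₂ =
  cong (c2 ∷_) (trans (count⇒ones w (suc-injective y₁) y₂ (suc-injective x₂)) (cong ones x₁))
count⇒[2] (c2̄ ∷ w) () _  _  _
count⇒[2] (c1̄ ∷ w) _  y₁ x₂ _ =
  contradiction (subst₂ _≤_ x₂ (suc-injective y₁) (#X₂≤#Y₁ w)) λ ()

any-ones-2̄-ones : ∀ {P} b d → P c1 ≡ false → P c2̄ ≡ false → any P (ones b ++ c2̄ ∷ ones d) ≡ false
any-ones-2̄-ones zero    d h₁ h₂ rewrite h₂ = any-ones d h₁
any-ones-2̄-ones (suc b) d h₁ h₂ rewrite h₁ = any-ones-2̄-ones b d h₁ h₂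

hasInv-ones-2̄-ones : ∀ i b d → hasInv i (ones b ++ c2̄ ∷ ones d) ≡ false
hasInv-ones-2̄-ones i1 zero    d rewrite any-ones {isY i1} d refl = hasInv-ones i1 d
hasInv-ones-2̄-ones i1 (suc b) d rewrite any-ones-2̄-ones {isY i1} b d refl refl =
  hasInv-ones-2̄-ones i1 b d
hasInv-ones-2̄-ones i2 zero    d = hasInv-ones i2 d
hasInv-ones-2̄-ones i2 (suc b) d = hasInv-ones-2̄-ones i2 b d

-- Words determined by their statistics ε̈ and φ̈

ε̈-noInv : ∀ i w → hasInv i w ≡ false → ε̈ i w ≡ fin (#Y i w)
ε̈-noInv i w h rewrite h = refl

φ̈-noInv : ∀ i w → hasInv i w ≡ false → φ̈ i w ≡ fin (#X i w)
φ̈-noInv i w h rewrite h = refl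

ε̈-fin⇒#Y : ∀ i w {n} → ε̈ i w ≡ fin n → #Y i w ≡ n
ε̈-fin⇒#Y i w h with hasInv i w
ε̈-fin⇒#Y i w refl | false = refl

φ̈-fin⇒#X : ∀ i w {n} → φ̈ i w ≡ fin n → #X i w ≡ n
φ̈-fin⇒#X i w h with hasInv i w
φ̈-fin⇒#X i w refl | false = refl

ε̈≡⇒hasInv≡ : ∀ i u v → ε̈ i u ≡ ε̈ i v → hasInv i u ≡ hasInv i v
ε̈≡⇒hasInv≡ i u v e with hasInv i u | hasInv i v
... | true  | true  = refl
... | false | false = refl
ε̈≡⇒hasInv≡ i u v () | true  | false
ε̈≡⇒hasInv≡ i u v () | false | true

record SameStats (u v : Word) : Set where
  field
    ε̈-≡ : ∀ i → ε̈ i u ≡ ε̈ i v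
    φ̈-≡ : ∀ i → φ̈ i u ≡ φ̈ i v
open SameStats

sameStats-sym : ∀ {u v} → SameStats u v → SameStats v u
sameStats-sym s = record { ε̈-≡ = λ i → sym (ε̈-≡ s i) ; φ̈-≡ = λ i → sym (φ̈-≡ s i) }

sameStats-#Y : ∀ {i u v} → SameStats u v → hasInv i v ≡ false → #Y i u ≡ #Y i v
sameStats-#Y {i} {u} {v} s h = ε̈-fin⇒#Y i u (trans (ε̈-≡ s i) (ε̈-noInv i v h))

sameStats-#X : ∀ {i u v} → SameStats u v → hasInv i v ≡ false → #X i u ≡ #X i v
sameStats-#X {i} {u} {v} s h = φ̈-fin⇒#X i u (trans (φ̈-≡ s i) (φ̈-noInv i v h))

StatDetermined : Word → Set
StatDetermined w = ∀ u → SameStats u w → u ≡ w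

statDetermined-ones : ∀ n → StatDetermined (ones n)
statDetermined-ones n u s =
  trans (count⇒ones u (vanish i1) (vanish i2) #X₂≡0) (cong ones #X₁≡n)
  where
    vanish : ∀ i → #Y i u ≡ 0
    vanish i1 = trans (sameStats-#Y s (hasInv-ones i1 n)) (count-ones-false n refl)
    vanish i2 = trans (sameStats-#Y s (hasInv-ones i2 n)) (count-ones-false n refl)
    #X₂≡0 : #X i2 u ≡ 0
    #X₂≡0 = trans (sameStats-#X s (hasInv-ones i2 n)) (count-ones-false n refl)
    #X₁≡n : #X i1 u ≡ n
    #X₁≡n = trans (sameStats-#X s (hasInv-ones i1 n)) (count-ones-true n refl)

statDetermined-[2] : StatDetermined [ c2 ]
statDetermined-[2] u s =
  count⇒[2] u (sameStats-#X s refl) (sameStats-#Y s refl) (sameStats-#X s refl) (sameStats-#Y s refl)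

statDetermined-[1̄] : StatDetermined [ c1̄ ]
statDetermined-[1̄] u s =
  trans (count⇒1̄s u (sameStats-#X s refl) (sameStats-#X s refl) (sameStats-#Y s refl))
        (cong (λ n → replicate n c1̄) (sameStats-#Y s refl))

sameStats-ones-2̄ : ∀ k u → SameStats u (ones k ++ [ c2̄ ]) →
                   ∃₂ λ b d → b + d ≡ k × u ≡ ones b ++ c2̄ ∷ ones d
sameStats-ones-2̄ k u s
  with count⇒ones-2̄-ones u
         (trans (sameStats-#Y s (hasInv-ones-2̄-ones i1 k 0)) (count-ones-2̄ k refl))
         (trans (sameStats-#X s (hasInv-ones-2̄-ones i2 k 0)) (count-ones-2̄ k refl))
         (trans (sameStats-#Y s (hasInv-ones-2̄-ones i2 k 0)) (count-ones-2̄ k refl))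
... | b , d , 1+b+d≡ , u≡ = b , d , suc-injective (trans 1+b+d≡ #X₁≡1+k) , u≡
  where
    #X₁≡1+k : #X i1 u ≡ suc k
    #X₁≡1+k = begin
      #X i1 u                                ≡⟨ sameStats-#X s (hasInv-ones-2̄-ones i1 k 0) ⟩
      #X i1 (ones k ++ [ c2̄ ])              ≡⟨ count-++ (isX i1) (ones k) [ c2̄ ] ⟩
      #X i1 (ones k) + 1                     ≡⟨ cong (_+ 1) (count-ones-true k refl) ⟩
      k + 1                                  ≡⟨ +-comm k 1 ⟩
      suc k                                  ∎
      where open ≡-Reasoning

statDetermined-[2̄] : StatDetermined [ c2̄ ]
statDetermined-[2̄] u s with sameStats-ones-2̄ 0 u s
... | zero , zero , _ , u≡ = u≡

statDetermined-letter : ∀ c → StatDetermined [ c ]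
statDetermined-letter c1  = statDetermined-ones 1
statDetermined-letter c2  = statDetermined-[2]
statDetermined-letter c2̄ = statDetermined-[2̄]
statDetermined-letter c1̄ = statDetermined-[1̄]

-- Rigid words

module _ {p q : Word} {ψ : Word → Word} (I : QCIso p q ψ) where
  open QCIso I

  sameStats-image : ∀ {x} → Reach p x → SameStats (ψ x) x
  sameStats-image {x} r = record { ε̈-≡ = λ i → pres-ε i x r ; φ̈-≡ = λ i → pres-φ i x r }

  track-f : ∀ i {x y x′ y′} → Reach p x → ψ x ≡ y → f̈ i x ≡ just x′ → f̈ i y ≡ just y′ →
            Reach p x′ × ψ x′ ≡ y′
  track-f i {x} {y} {x′} {y′} r ψx≡y fx fy = stepF i r fx , just-injective (begin
    just (ψ x′)           ≡⟨ cong (Maybe.map ψ) fx ⟨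
    Maybe.map ψ (f̈ i x)  ≡⟨ comm-f i x r ⟨
    f̈ i (ψ x)            ≡⟨ cong (f̈ i) ψx≡y ⟩
    f̈ i y                ≡⟨ fy ⟩
    just y′               ∎)
    where open ≡-Reasoning

  pinned-f : ∀ i {x x′} → Reach p x → ψ x ≡ x → f̈ i x ≡ just x′ → ψ x′ ≡ x′
  pinned-f i r ψx≡x fx = proj₂ (track-f i r ψx≡x fx fx)

  pinned-statDetermined : ∀ {x} → Reach p x → StatDetermined x → ψ x ≡ x
  pinned-statDetermined r det = det _ (sameStats-image r)

∼̈-sameStats : ∀ {u v} → u ∼̈ v → SameStats u v
∼̈-sameStats (ψ , I) = sameStats-sym (subst (λ w → SameStats w _) (QCIso.base I) (sameStats-image I here))

statDetermined-∼̈ : ∀ {u w} → StatDetermined w → u ∼̈ w → u ≡ w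
statDetermined-∼̈ det u∼w = det _ (∼̈-sameStats u∼w)

Rigid : Word → Set
Rigid a = ∀ b → a ∼̈ b → b ≡ a

rigid-if-pinned : ∀ {a} → (∀ {b ψ} → QCIso a b ψ → ψ a ≡ a) → Rigid a
rigid-if-pinned pin b (ψ , I) = trans (sym (QCIso.base I)) (pin I)

statDetermined⇒rigid : ∀ {a} → StatDetermined a → Rigid a
statDetermined⇒rigid det = rigid-if-pinned λ I → pinned-statDetermined I here det

twos-snoc : ∀ j (w : Word) → twos j ++ c2 ∷ w ≡ twos (suc j) ++ w
twos-snoc zero    w = refl
twos-snoc (suc j) w = cong (c2 ∷_) (twos-snoc j w)

hasInv₁-twos : ∀ j w → hasInv i1 (twos j ++ w) ≡ hasInv i1 w
hasInv₁-twos zero    w = refl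
hasInv₁-twos (suc j) w = hasInv₁-twos j w

replaceFirst-twos : ∀ j w →
                    replaceFirst (fL i1) (twos j ++ w) ≡ Maybe.map (twos j ++_) (replaceFirst (fL i1) w)
replaceFirst-twos zero    w with replaceFirst (fL i1) w
... | just _  = refl
... | nothing = refl
replaceFirst-twos (suc j) w rewrite replaceFirst-twos j w with replaceFirst (fL i1) w
... | just _  = refl
... | nothing = refl

f̈₁-after-twos : ∀ j {a a′} w → fL i1 a ≡ just a′ → hasInv i1 (a ∷ w) ≡ false →
                f̈ i1 (twos j ++ a ∷ w) ≡ just (twos j ++ a′ ∷ w)
f̈₁-after-twos j {a} w fa h rewrite hasInv₁-twos j (a ∷ w) | h | replaceFirst-twos j (a ∷ w) | fa = refl

replaceLast-twos-ones : ∀ j k →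
                        replaceLast (eL i1) (twos (suc j) ++ ones k) ≡ just (twos j ++ ones (suc k))
replaceLast-twos-ones zero    k rewrite replaceLast-ones (eL i1) k refl = refl
replaceLast-twos-ones (suc j) k rewrite replaceLast-twos-ones j k = refl

ë₁-twos-ones : ∀ j k → ë i1 (twos (suc j) ++ ones k) ≡ just (twos j ++ ones (suc k))
ë₁-twos-ones j k rewrite hasInv₁-twos j (ones k) | hasInv-ones i1 k = replaceLast-twos-ones j k

f̈₁-twos-ones : ∀ j k → f̈ i1 (twos j ++ ones (suc k)) ≡ just (twos j ++ c2 ∷ ones k)
f̈₁-twos-ones j k = f̈₁-after-twos j (ones k) refl (hasInv-ones i1 (suc k))

rigid-ones : ∀ n → Rigid (ones n)
rigid-ones n = statDetermined⇒rigid (statDetermined-ones n)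

-- ψ commutes with the operators, so its fixed points are closed under f̈-steps within the
-- component: a word is rigid once ë-steps lead from it to a word determined by its
-- statistics and f̈-steps lead back.
rigid-2-ones : ∀ k → Rigid (c2 ∷ ones k)
rigid-2-ones k = rigid-if-pinned λ I →
  let r = stepE i1 here (ë₁-twos-ones 0 k) in
  pinned-f I i1 r (pinned-statDetermined I r (statDetermined-ones (suc k))) (f̈₁-twos-ones 0 k)

rigid-2̄-2-ones : ∀ k → Rigid (c2̄ ∷ c2 ∷ ones k)
rigid-2̄-2-ones k = rigid-if-pinned λ I →
  let r₁ = stepE i2 here ë₂
      r₂ = stepE i1 r₁ (ë₁-twos-ones 1 k)
      r₃ = stepE i1 r₂ (ë₁-twos-ones 0 (suc k))
      pin₃ = pinned-statDetermined I r₃ (statDetermined-ones (suc (suc k)))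
      pin₂ = pinned-f I i1 r₃ pin₃ (f̈₁-twos-ones 0 (suc k))
      pin₁ = pinned-f I i1 r₂ pin₂ (f̈₁-twos-ones 1 k)
  in pinned-f I i2 r₁ pin₁ f̈₂
  where
    ë₂ : ë i2 (c2̄ ∷ c2 ∷ ones k) ≡ just (c2 ∷ c2 ∷ ones k)
    ë₂ rewrite any-ones {isY i2} k refl | hasInv-ones i2 k | replaceLast-ones (eL i2) k refl = refl
    f̈₂ : f̈ i2 (c2 ∷ c2 ∷ ones k) ≡ just (c2̄ ∷ c2 ∷ ones k)
    f̈₂ rewrite any-ones {isY i2} k refl | hasInv-ones i2 k = refl

W : ℕ → ℕ → ℕ → Word
W j m d = twos j ++ ones m ++ c2̄ ∷ ones d

f̈₁-W : ∀ j m d → f̈ i1 (W j (suc m) d) ≡ just (W (suc j) m d)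
f̈₁-W j m d =
  trans (f̈₁-after-twos j (ones m ++ c2̄ ∷ ones d) refl (hasInv-ones-2̄-ones i1 (suc m) d))
        (cong just (twos-snoc j _))

f̈₁-W-2̄ : ∀ j d → f̈ i1 (W j 0 d) ≡ just (twos j ++ c1̄ ∷ ones d)
f̈₁-W-2̄ j d = f̈₁-after-twos j (ones d) refl (hasInv-ones-2̄-ones i1 0 d)

hasInv₂-W : ∀ j m d → hasInv i2 (W (suc j) m d) ≡ true
hasInv₂-W j m d =
  cong (_∨ hasInv i2 (W j m d)) (any-++ʳ (isY i2) (twos j) (any-++ʳ (isY i2) (ones m) {c2̄ ∷ ones d} refl))

any₂-twos-1̄-ones : ∀ j d → any (isY i2) (twos j ++ c1̄ ∷ ones d) ≡ false
any₂-twos-1̄-ones zero    d = any-ones d refl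
any₂-twos-1̄-ones (suc j) d = any₂-twos-1̄-ones j d

hasInv₂-twos-1̄-ones : ∀ j d → hasInv i2 (twos j ++ c1̄ ∷ ones d) ≡ false
hasInv₂-twos-1̄-ones zero    d = hasInv-ones i2 d
hasInv₂-twos-1̄-ones (suc j) d rewrite any₂-twos-1̄-ones j d = hasInv₂-twos-1̄-ones j d

module _ {b d : ℕ} {ψ : Word → Word} (I : QCIso (W 0 (b + d) 0) (W 0 b d) ψ) where

  f̈₁-iterate : ∀ j m → j + m ≡ b →
               Reach (W 0 (b + d) 0) (W j (m + d) 0) × ψ (W j (m + d) 0) ≡ W j m d
  f̈₁-iterate zero    m refl = here , QCIso.base I
  f̈₁-iterate (suc j) m j+m≡b with f̈₁-iterate j (suc m) (trans (+-suc j m) j+m≡b)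
  ... | r , ψ≡ = track-f I i1 r ψ≡ (f̈₁-W j (m + d) 0) (f̈₁-W j m d)

-- f̈₁ turns the ones of the source 1ᵇ⁺ᵈ 2̄ and of its image 1ᵇ 2̄ 1ᵈ into twos in step.
-- At step b + 1 the image's 2̄ becomes 1̄, leaving no 2-inversion, while for d > 0 the
-- source still has a 2̄ behind a 2.
trailing-ones-absent : ∀ b d {ψ} → QCIso (W 0 (b + d) 0) (W 0 b d) ψ → d ≡ 0
trailing-ones-absent b zero    I = refl
trailing-ones-absent b (suc d) {ψ} I with f̈₁-iterate I b 0 (+-identityʳ b)
... | r , ψ≡ with track-f I i1 r ψ≡ (f̈₁-W b d 0) (f̈₁-W-2̄ b (suc d))
... | r′ , ψ≡′ = contradiction false≡true λ ()
  where
    false≡true : false ≡ true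
    false≡true = begin
      false                                      ≡⟨ hasInv₂-twos-1̄-ones b (suc d) ⟨
      hasInv i2 (twos b ++ c1̄ ∷ ones (suc d))  ≡⟨ cong (hasInv i2) ψ≡′ ⟨
      hasInv i2 (ψ (W (suc b) d 0))              ≡⟨ ε̈≡⇒hasInv≡ i2 (ψ (W (suc b) d 0)) (W (suc b) d 0)
                                                                (QCIso.pres-ε I i2 _ r′) ⟩
      hasInv i2 (W (suc b) d 0)                  ≡⟨ hasInv₂-W b d 0 ⟩
      true                                       ∎
      where open ≡-Reasoning

rigid-ones-2̄ : ∀ k → Rigid (ones k ++ [ c2̄ ])
rigid-ones-2̄ k q q∼@(ψ , I) with sameStats-ones-2̄ k q (sameStats-sym (∼̈-sameStats q∼))
... | b , d , refl , refl with trailing-ones-absent b d I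
... | refl = cong (λ n → ones n ++ [ c2̄ ]) (sym (+-identityʳ b))

-- Short factors of u[ N ]

prefix-of-ones : ∀ N a {y z} → a ++ y ≡ ones N ++ z → length a ≤ N → a ≡ ones (length a)
prefix-of-ones N       []         e le       = refl
prefix-of-ones (suc N) (c1  ∷ a) e (s≤s le) = cong (c1 ∷_) (prefix-of-ones N a (∷-injectiveʳ e) le)
prefix-of-ones (suc N) (c2  ∷ a) () _
prefix-of-ones (suc N) (c2̄ ∷ a) () _
prefix-of-ones (suc N) (c1̄ ∷ a) () _
prefix-of-ones zero    (_   ∷ a) _  ()

prefix-of-ones-2̄ : ∀ N a {y} → a ++ y ≡ ones N ++ [ c2̄ ] → a ≡ ones (length a) ⊎ a ≡ ones N ++ [ c2̄ ]
prefix-of-ones-2̄ N       []             e = inj₁ refl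
prefix-of-ones-2̄ (suc N) (c1  ∷ a)     e =
  Sum.map (cong (c1 ∷_)) (cong (c1 ∷_)) (prefix-of-ones-2̄ N a (∷-injectiveʳ e))
prefix-of-ones-2̄ zero    (c2̄ ∷ a) {y} e = inj₂ (cong (c2̄ ∷_) (++-conicalˡ a y (∷-injectiveʳ e)))
prefix-of-ones-2̄ zero    (c1  ∷ a) ()
prefix-of-ones-2̄ zero    (c2  ∷ a) ()
prefix-of-ones-2̄ zero    (c1̄ ∷ a) ()
prefix-of-ones-2̄ (suc N) (c2  ∷ a) ()
prefix-of-ones-2̄ (suc N) (c2̄ ∷ a) ()
prefix-of-ones-2̄ (suc N) (c1̄ ∷ a) ()

infix-of-ones-2̄ : ∀ N x a {y} → x ++ a ++ y ≡ ones N ++ [ c2̄ ] →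
                  a ≡ ones (length a) ⊎ ∃ λ k → a ≡ ones k ++ [ c2̄ ]
infix-of-ones-2̄ N       []             a e = Sum.map₂ (N ,_) (prefix-of-ones-2̄ N a e)
infix-of-ones-2̄ (suc N) (c1  ∷ x)     a e = infix-of-ones-2̄ N x a (∷-injectiveʳ e)
infix-of-ones-2̄ zero    (c2̄ ∷ x) a {y} e
  with ++-conicalˡ a y (++-conicalʳ x (a ++ y) (∷-injectiveʳ e))
... | refl = inj₁ refl
infix-of-ones-2̄ zero    (c1  ∷ x) a ()
infix-of-ones-2̄ zero    (c2  ∷ x) a ()
infix-of-ones-2̄ zero    (c1̄ ∷ x) a ()
infix-of-ones-2̄ (suc N) (c2  ∷ x) a ()
infix-of-ones-2̄ (suc N) (c2̄ ∷ x) a ()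
infix-of-ones-2̄ (suc N) (c1̄ ∷ x) a ()

u[_] v[_] : ℕ → Word
u[ N ] = c2̄ ∷ c2 ∷ ones N ++ [ c2̄ ]
v[ N ] = c2̄ ∷ c2 ∷ c2̄ ∷ ones N

short-factor-rigid : ∀ N x a {y} → x ++ a ++ y ≡ u[ N ] → length a ≤ N → Rigid a
short-factor-rigid N [] [] _ _ = rigid-ones 0
short-factor-rigid N [] (c2̄ ∷ []) _ _ = rigid-ones-2̄ 0
short-factor-rigid N [] (c2̄ ∷ c2 ∷ a) e (s≤s (s≤s le)) =
  subst (λ a → Rigid (c2̄ ∷ c2 ∷ a))
        (sym (prefix-of-ones N a (∷-injectiveʳ (∷-injectiveʳ e)) (m≤n⇒m≤1+n (m≤n⇒m≤1+n le))))
        (rigid-2̄-2-ones (length a))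
short-factor-rigid N (c2̄ ∷ []) [] _ _ = rigid-ones 0
short-factor-rigid N (c2̄ ∷ []) (c2 ∷ a) e (s≤s le) =
  subst (λ a → Rigid (c2 ∷ a))
        (sym (prefix-of-ones N a (∷-injectiveʳ (∷-injectiveʳ e)) (m≤n⇒m≤1+n le)))
        (rigid-2-ones (length a))
short-factor-rigid N (c2̄ ∷ c2 ∷ x) a e _ with infix-of-ones-2̄ N x a (∷-injectiveʳ (∷-injectiveʳ e))
... | inj₁ a≡       = subst Rigid (sym a≡) (rigid-ones (length a))
... | inj₂ (k , a≡) = subst Rigid (sym a≡) (rigid-ones-2̄ k)
short-factor-rigid N [] (c2̄ ∷ c1  ∷ a) () _
short-factor-rigid N [] (c2̄ ∷ c2̄ ∷ a) () _
short-factor-rigid N [] (c2̄ ∷ c1̄ ∷ a) () _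
short-factor-rigid N [] (c1  ∷ a) () _
short-factor-rigid N [] (c2  ∷ a) () _
short-factor-rigid N [] (c1̄ ∷ a) () _
short-factor-rigid N (c2̄ ∷ []) (c1  ∷ a) () _
short-factor-rigid N (c2̄ ∷ []) (c2̄ ∷ a) () _
short-factor-rigid N (c2̄ ∷ []) (c1̄ ∷ a) () _
short-factor-rigid N (c2̄ ∷ c1  ∷ x) a () _
short-factor-rigid N (c2̄ ∷ c2̄ ∷ x) a () _
short-factor-rigid N (c2̄ ∷ c1̄ ∷ x) a () _
short-factor-rigid N (c1  ∷ x) a () _
short-factor-rigid N (c2  ∷ x) a () _
short-factor-rigid N (c1̄ ∷ x) a () _

AllInversions : Word → Set
AllInversions w = ∀ i → hasInv i w ≡ true

ε̈-inv : ∀ i w → hasInv i w ≡ true → ε̈ i w ≡ ∞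
ε̈-inv i w h rewrite h = refl

φ̈-inv : ∀ i w → hasInv i w ≡ true → φ̈ i w ≡ ∞
φ̈-inv i w h rewrite h = refl

ë-inv : ∀ i w → hasInv i w ≡ true → ë i w ≡ nothing
ë-inv i w h rewrite h = refl

f̈-inv : ∀ i w → hasInv i w ≡ true → f̈ i w ≡ nothing
f̈-inv i w h rewrite h = refl

reach-isolated : ∀ {u x} → AllInversions u → Reach u x → x ≡ u
reach-isolated hu here = refl
reach-isolated {u} hu (stepE i r e) with reach-isolated hu r
... | refl = contradiction (trans (sym (ë-inv i u (hu i))) e) λ ()
reach-isolated {u} hu (stepF i r e) with reach-isolated hu r
... | refl = contradiction (trans (sym (f̈-inv i u (hu i))) e) λ ()

isolated-∼̈ : ∀ {u v} → AllInversions u → AllInversions v → wt u ≡ wt v → u ∼̈ v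
isolated-∼̈ {u} {v} hu hv wt≡ = (λ _ → v) , record
  { maps    = λ _ _ → here
  ; inj     = λ _ _ rx ry _ → trans (reach-isolated hu rx) (sym (reach-isolated hu ry))
  ; surj    = λ _ ry → u , here , sym (reach-isolated hv ry)
  ; base    = refl
  ; pres-wt = λ _ r → trans (sym wt≡) (cong wt (sym (reach-isolated hu r)))
  ; pres-ε  = λ i x r → trans (ε̈-inv i v (hv i)) (sym (ε̈-inv i x (invAt r i)))
  ; pres-φ  = λ i x r → trans (φ̈-inv i v (hv i)) (sym (φ̈-inv i x (invAt r i)))
  ; comm-e  = λ i x r → trans (ë-inv i v (hv i)) (cong (Maybe.map _) (sym (ë-inv i x (invAt r i))))
  ; comm-f  = λ i x r → trans (f̈-inv i v (hv i)) (cong (Maybe.map _) (sym (f̈-inv i x (invAt r i))))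
  }
  where
    invAt : ∀ {x} → Reach u x → AllInversions x
    invAt r rewrite reach-isolated hu r = hu

u∼̈v : ∀ N → u[ N ] ∼̈ v[ N ]
u∼̈v N = isolated-∼̈ inv-u inv-v (wt-cong {u[ N ]} {v[ N ]} λ P →
  count-cong-++ˡ P (c2̄ ∷ c2 ∷ []) {ones N ++ [ c2̄ ]} {c2̄ ∷ ones N} (count-swap P (ones N) [ c2̄ ]))
  where
    inv-u : AllInversions u[ N ]
    inv-u i1 = refl
    inv-u i2 = cong (_∨ hasInv i2 (ones N ++ [ c2̄ ])) (any-++ʳ (isY i2) (ones N) refl)
    inv-v : AllInversions v[ N ]
    inv-v i1 = refl
    inv-v i2 = refl

-- Relations that cannot move u[ N ]

module _ {A : Set} (P : List A → Set) where

  Preserves : List A → List A → Set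
  Preserves α β = ∀ x y → P (x ++ α ++ y) → P (x ++ β ++ y)

  preserves-cong : ∀ {α β} p q → Preserves α β → Preserves (p ++ α ++ q) (p ++ β ++ q)
  preserves-cong {α} {β} p q pres x y =
    subst P (sym (reassoc β)) ∘ pres (x ++ p) (q ++ y) ∘ subst P (reassoc α)
    where
      reassoc : ∀ γ → x ++ (p ++ γ ++ q) ++ y ≡ (x ++ p) ++ γ ++ q ++ y
      reassoc γ = begin
        x ++ (p ++ γ ++ q) ++ y     ≡⟨ cong (x ++_) (++-assoc p (γ ++ q) y) ⟩
        x ++ p ++ (γ ++ q) ++ y     ≡⟨ cong (λ w → x ++ p ++ w) (++-assoc γ q y) ⟩
        x ++ p ++ γ ++ q ++ y       ≡⟨ ++-assoc x p (γ ++ q ++ y) ⟨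
        (x ++ p) ++ γ ++ q ++ y     ∎
        where open ≡-Reasoning

  gen-preserves : ∀ {R} → (∀ {a b} → (a , b) ∈ R → Preserves a b × Preserves b a) →
                  ∀ {α β} → Gen R α β → Preserves α β × Preserves β α
  gen-preserves hR (gen m)       = hR m
  gen-preserves hR grefl         = (λ _ _ → id) , (λ _ _ → id)
  gen-preserves hR (gsym g)      = swap (gen-preserves hR g)
  gen-preserves hR (gtrans g h)  =
    let (g⇒ , g⇐) = gen-preserves hR g ; (h⇒ , h⇐) = gen-preserves hR h
    in (λ x y → h⇒ x y ∘ g⇒ x y) , (λ x y → g⇐ x y ∘ h⇐ x y)
  gen-preserves hR (gcong p q g) =
    Product.map (preserves-cong p q) (preserves-cong p q) (gen-preserves hR g)

  gen-invariant : ∀ {R} → (∀ {a b} → (a , b) ∈ R → Preserves a b × Preserves b a) →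
                  ∀ {α β} → Gen R α β → P α → P β
  gen-invariant hR {α} {β} g =
    subst P (++-identityʳ β) ∘ proj₁ (gen-preserves hR g) [] [] ∘ subst P (sym (++-identityʳ α))

relSize : {A : Set} → (List A → Word) → List (List A × List A) → ℕ
relSize G []             = 0
relSize G ((a , b) ∷ R) = length (G a) + length (G b) + relSize G R

relSize-bound : ∀ {A : Set} (G : List A → Word) R {a b} → (a , b) ∈ R →
                length (G a) ≤ relSize G R × length (G b) ≤ relSize G R
relSize-bound G ((a , b) ∷ R) (here refl) =
  ≤-trans (m≤m+n _ _) (m≤m+n _ _) , ≤-trans (m≤n+m _ (length (G a))) (m≤m+n _ _)
relSize-bound G ((a , b) ∷ R) (there m) =
  Product.map (λ le → ≤-trans le (m≤n+m _ _)) (λ le → ≤-trans le (m≤n+m _ _)) (relSize-bound G R m)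

module _ {A : Set} (G : List A → Word) (G-++ : ∀ x y → G (x ++ y) ≡ G x ++ G y) where

  rigid-preserves : ∀ N {a b} → G a ∼̈ G b → length (G a) ≤ N → Preserves (λ w → G w ≡ u[ N ]) a b
  rigid-preserves N {a} {b} a∼b len x y Gxay≡u = begin
    G (x ++ b ++ y)      ≡⟨ G₃ b ⟩
    G x ++ G b ++ G y    ≡⟨ cong (λ w → G x ++ w ++ G y) Gb≡Ga ⟩
    G x ++ G a ++ G y    ≡⟨ G₃ a ⟨
    G (x ++ a ++ y)      ≡⟨ Gxay≡u ⟩
    u[ N ]               ∎
    where
      open ≡-Reasoning
      G₃ : ∀ γ → G (x ++ γ ++ y) ≡ G x ++ G γ ++ G y
      G₃ γ = trans (G-++ x (γ ++ y)) (cong (G x ++_) (G-++ γ y))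
      Gb≡Ga : G b ≡ G a
      Gb≡Ga = short-factor-rigid N (G x) (G a) (trans (sym (G₃ a)) Gxay≡u) len (G b) a∼b

  ¬gen-u-v : ∀ R → (∀ {a b} → Gen R a b → G a ∼̈ G b) → ∀ {α β} →
             G α ≡ u[ suc (relSize G R) ] → G β ≡ v[ suc (relSize G R) ] → ¬ Gen R α β
  ¬gen-u-v R sound Gα≡u Gβ≡v g = contradiction (trans (sym Gβ≡v) (gen-invariant _ hR g Gα≡u)) λ ()
    where
      -- a successor, because u[ 0 ] ≡ v[ 0 ]
      N : ℕ
      N = suc (relSize G R)
      hR : ∀ {a b} → (a , b) ∈ R →
           Preserves (λ w → G w ≡ u[ N ]) a b × Preserves (λ w → G w ≡ u[ N ]) b a
      hR m = let (la , lb) = relSize-bound G R m in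
        rigid-preserves N (sound (gen m)) (m≤n⇒m≤1+n la) ,
        rigid-preserves N (sound (gsym (gen m))) (m≤n⇒m≤1+n lb)

¬finitelyGenerated : ¬ FinitelyGenerated
¬finitelyGenerated (R , iff) =
  ¬gen-u-v id (λ _ _ → refl) R (proj₁ (iff _ _)) refl refl (proj₂ (iff _ _) (u∼̈v _))

concatMap-onto : ∀ {A : Set} (g : A → Word) → (∀ c → ∃ λ α → concatMap g α ≡ [ c ]) →
                 ∀ w → ∃ λ α → concatMap g α ≡ w
concatMap-onto g onto-letters []      = [] , refl
concatMap-onto g onto-letters (c ∷ w) with onto-letters c | concatMap-onto g onto-letters w
... | α , α↦c | β , β↦w = α ++ β , trans (concatMap-++ g α β) (cong₂ _++_ α↦c β↦w)

¬finitelyPresented : ¬ FinitelyPresented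
¬finitelyPresented (n , g , R , onto , iff) =
  let αu , αu↦u = lift u[ N ]
      αv , αv↦v = lift v[ N ]
  in ¬gen-u-v (concatMap g) (concatMap-++ g) R (proj₁ (iff _ _)) αu↦u αv↦v
       (proj₂ (iff αu αv) (subst₂ _∼̈_ (sym αu↦u) (sym αv↦v) (u∼̈v N)))
  where
    N : ℕ
    N = suc (relSize (concatMap g) R)
    lift : ∀ w → ∃ λ α → concatMap g α ≡ w
    lift = concatMap-onto g λ c →
      Product.map₂ (statDetermined-∼̈ (statDetermined-letter c)) (onto [ c ])

theorem9p36 : (¬ FinitelyGenerated) × (¬ FinitelyPresented)
theorem9p36 = ¬finitelyGenerated , ¬finitelyPresented
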